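{- Let $G$ and $H$ be connected graphs, let $x,x'$ be two adjacent vertices of $G$ and let $y,y'$ be two adjacent vertices of $H$. If $X$ is a total mutual-visibility set of $G\Box H$ of maximum cardinality and $(x,y)\in X$, then $(x',y')\notin X$.
   Context: All graphs are finite, simple and undirected. The Cartesian product $G\Box H$ has vertex set $V(G)\times V(H)$, with $(x,y)$ adjacent to $(x',y')$ iff either $x=x'$ and $yy'\in E(H)$, or $xx'\in E(G)$ and $y=y'$. For a graph $F$ and $X\subseteq V(F)$, two vertices $u,v$ are $X$-visible if there is a shortest $u,v$-path in $F$ none of whose internal vertices lies in $X$. $X$ is a total mutual-visibility set of $F$ if every two vertices of $F$ are $X$-visible. -}

module Defs where

open import Data.Nat using (ℕ; zero; suc; _*_; _≤_)
open import Data.Fin using (Fin; combine; remQuot)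
open import Data.Fin.Subset using (Subset; _∈_; _∉_; ∣_∣)
open import Data.Product using (Σ; _×_; _,_; proj₁; proj₂)
open import Data.Sum using (_⊎_)
open import Data.List using (List; []; _∷_)
open import Data.List.Relation.Unary.All using (All)
open import Relation.Nullary using (¬_)
open import Relation.Binary.PropositionalEquality using (_≡_)

record Graph : Set₁ where
  field
    n      : ℕ
    Adj    : Fin n → Fin n → Set
    sym    : ∀ {u v} → Adj u v → Adj v u
    irrefl : ∀ {u} → ¬ Adj u u
open Graph public

module _ (G : Graph) where
  data Walk : Fin (n G) → Fin (n G) → Set where
    [] : ∀ {u} → Walk u u
    cons : ∀ {u} (w : Fin (n G)) {v} → Adj G u w → Walk w v → Walk u v

  len : ∀ {u v} → Walk u v → ℕ
  len [] = zero
  len (cons _ _ p) = suc (len p)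

  interior : ∀ {u v} → Walk u v → List (Fin (n G))
  interior [] = []
  interior (cons w e []) = []
  interior (cons w e (cons w' e' p)) = w ∷ interior (cons w' e' p)

  IsShortest : ∀ {u v} → Walk u v → Set
  IsShortest {u} {v} p = (q : Walk u v) → len p ≤ len q

  Connected : Set
  Connected = (u v : Fin (n G)) → Walk u v

  Visible : Subset (n G) → Fin (n G) → Fin (n G) → Set
  Visible X u v = Σ (Walk u v) λ p → IsShortest p × All (λ w → w ∉ X) (interior p)

  IsTotalMutualVisibilitySet : Subset (n G) → Set
  IsTotalMutualVisibilitySet X = (u v : Fin (n G)) → Visible X u v

  IsMaxTotalMutualVisibilitySet : Subset (n G) → Set
  IsMaxTotalMutualVisibilitySet X =
    IsTotalMutualVisibilitySet X ×
    ((Y : Subset (n G)) → IsTotalMutualVisibilitySet Y → ∣ Y ∣ ≤ ∣ X ∣)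

-- Cartesian product; vertex (x , y) is encoded as combine x y : Fin (n G * n H).
_□_ : Graph → Graph → Graph
G □ H = record
  { n = n G * n H
  ; Adj = λ a b → PAdj (remQuot (n H) a) (remQuot (n H) b)
  ; sym = λ {a} {b} → psym (remQuot (n H) a) (remQuot (n H) b)
  ; irrefl = λ {a} → pirr (remQuot (n H) a)
  }
  where
  PAdj : Fin (n G) × Fin (n H) → Fin (n G) × Fin (n H) → Set
  PAdj (x , y) (x' , y') = (x ≡ x' × Adj H y y') ⊎ (Adj G x x' × y ≡ y')
  psym : ∀ p q → PAdj p q → PAdj q p
  psym (x , y) (x' , y') (Data.Sum.inj₁ (Relation.Binary.PropositionalEquality.refl , e)) = Data.Sum.inj₁ (Relation.Binary.PropositionalEquality.refl , sym H e)
  psym (x , y) (x' , y') (Data.Sum.inj₂ (e , Relation.Binary.PropositionalEquality.refl)) = Data.Sum.inj₂ (sym G e , Relation.Binary.PropositionalEquality.refl)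
  pirr : ∀ p → ¬ PAdj p p
  pirr (x , y) (Data.Sum.inj₁ (_ , e)) = irrefl H e
  pirr (x , y) (Data.Sum.inj₂ (e , _)) = irrefl G e

{-# OPTIONS --safe #-}
module Submission where

-- (x', y) and (x, y') are at distance two in G □ H, and their only common
-- neighbours are (x, y) and (x', y'); so every shortest path between them has
-- one of these as its single internal vertex, which therefore cannot both lie
-- in a total mutual-visibility set.

open import Defs
open import Data.Fin using (Fin; combine; remQuot)
open import Data.Fin.Subset using (Subset; _∈_; _∉_)
open import Data.Fin.Properties using (remQuot-combine; combine-remQuot; combine-injectiveˡ)
open import Data.Product using (_×_; _,_; ∃-syntax; uncurry)
open import Data.Sum using (_⊎_; inj₁; inj₂; map)
open import Data.Empty using (⊥-elim)
open import Data.Nat using (s≤s)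
open import Data.List.Relation.Unary.All using (_∷_)
open import Relation.Nullary using (¬_)
open import Relation.Binary.PropositionalEquality
  using (_≡_; _≢_; refl; cong; subst; subst₂; trans) renaming (sym to ≡-sym)

module _ (G : Graph) {X : Subset (n G)} {a b c : Fin (n G)} where

  visible⇒common-neighbour∉ : a ≢ b → ¬ Adj G a b → Adj G a c → Adj G c b →
    Visible G X a b → ∃[ w ] Adj G a w × Adj G w b × w ∉ X
  visible⇒common-neighbour∉ a≢b _ _ _ ([] , _) = ⊥-elim (a≢b refl)
  visible⇒common-neighbour∉ _ ¬ab _ _ (cons _ ab [] , _) = ⊥-elim (¬ab ab)
  visible⇒common-neighbour∉ _ _ _ _ (cons w aw (cons _ wb []) , _ , w∉X ∷ _) =
    w , aw , wb , w∉X
  visible⇒common-neighbour∉ _ _ ac cb (cons _ _ (cons _ _ (cons _ _ _)) , shortest , _)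
    with shortest (cons c ac (cons b cb []))
  ... | s≤s (s≤s ())

module _ (G H : Graph) where

  -- Adj (G □ H) a b unfolds definitionally to ProductAdj (remQuot a) (remQuot b).
  ProductAdj : Fin (n G) × Fin (n H) → Fin (n G) × Fin (n H) → Set
  ProductAdj (x , y) (x' , y') = (x ≡ x' × Adj H y y') ⊎ (Adj G x x' × y ≡ y')

  combine-adj : ∀ {x x' y y'} → ProductAdj (x , y) (x' , y') →
    Adj (G □ H) (combine x y) (combine x' y')
  combine-adj {x} {x'} {y} {y'} =
    subst₂ ProductAdj (≡-sym (remQuot-combine x y)) (≡-sym (remQuot-combine x' y'))

  combine-adj⁻¹ : ∀ {x x' y y'} → Adj (G □ H) (combine x y) (combine x' y') →
    ProductAdj (x , y) (x' , y')
  combine-adj⁻¹ {x} {x'} {y} {y'} =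
    subst₂ ProductAdj (remQuot-combine x y) (remQuot-combine x' y')

  remQuot-adjˡ : ∀ {x y w} → Adj (G □ H) (combine x y) w →
    ProductAdj (x , y) (remQuot (n H) w)
  remQuot-adjˡ {x} {y} {w} = subst (λ p → ProductAdj p (remQuot (n H) w)) (remQuot-combine x y)

  remQuot-adjʳ : ∀ {x y w} → Adj (G □ H) w (combine x y) →
    ProductAdj (remQuot (n H) w) (x , y)
  remQuot-adjʳ {x} {y} {w} = subst (ProductAdj (remQuot (n H) w)) (remQuot-combine x y)

  remQuot≡⇒≡combine : ∀ {w x y} → remQuot {n G} (n H) w ≡ (x , y) → w ≡ combine x y
  remQuot≡⇒≡combine {w} eq = trans (≡-sym (combine-remQuot {n G} (n H) w)) (cong (uncurry combine) eq)

  module Square {x x' : Fin (n G)} {y y' : Fin (n H)}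
                (xx' : Adj G x x') (yy' : Adj H y y') where

    diagonal-distinct : combine x' y ≢ combine x y'
    diagonal-distinct eq with combine-injectiveˡ x' y x y' eq
    ... | refl = irrefl G xx'

    diagonal-nonadjacent : ¬ Adj (G □ H) (combine x' y) (combine x y')
    diagonal-nonadjacent e with combine-adj⁻¹ e
    ... | inj₁ (refl , _) = irrefl G xx'
    ... | inj₂ (_ , refl) = irrefl H yy'

    diagonal-common-neighbours : ∀ {r} → ProductAdj (x' , y) r → ProductAdj r (x , y') →
      r ≡ (x , y) ⊎ r ≡ (x' , y')
    diagonal-common-neighbours (inj₁ (refl , _)) (inj₁ (refl , _)) = ⊥-elim (irrefl G xx')
    diagonal-common-neighbours (inj₁ (refl , _)) (inj₂ (_ , refl)) = inj₂ refl
    diagonal-common-neighbours (inj₂ (_ , refl)) (inj₁ (refl , _)) = inj₁ refl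
    diagonal-common-neighbours (inj₂ (_ , refl)) (inj₂ (_ , refl)) = ⊥-elim (irrefl H yy')

    common-neighbour-of-diagonal : ∀ {w} →
      Adj (G □ H) (combine x' y) w → Adj (G □ H) w (combine x y') →
      w ≡ combine x y ⊎ w ≡ combine x' y'
    common-neighbour-of-diagonal aw wb =
      map remQuot≡⇒≡combine remQuot≡⇒≡combine
          (diagonal-common-neighbours (remQuot-adjˡ aw) (remQuot-adjʳ wb))

    diagonal-visible⇒corner∉ : ∀ {X} → Visible (G □ H) X (combine x' y) (combine x y') →
      combine x y ∉ X ⊎ combine x' y' ∉ X
    diagonal-visible⇒corner∉ visible
      with visible⇒common-neighbour∉ (G □ H) diagonal-distinct diagonal-nonadjacent
             (combine-adj (inj₂ (sym G xx' , refl))) (combine-adj (inj₁ (refl , yy'))) visible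
    ... | w , aw , wb , w∉X with common-neighbour-of-diagonal aw wb
    ...   | inj₁ refl = inj₁ w∉X
    ...   | inj₂ refl = inj₂ w∉X

lemma5p8 : (G H : Graph) → Connected G → Connected H →
    (x x' : Fin (n G)) (y y' : Fin (n H)) → Adj G x x' → Adj H y y' →
    (X : Subset (n (G □ H))) → IsMaxTotalMutualVisibilitySet (G □ H) X →
    combine x y ∈ X → combine x' y' ∉ X
lemma5p8 G H _ _ x x' y y' xx' yy' X (totalMutualVisibility , _) xy∈X x'y'∈X
  with Square.diagonal-visible⇒corner∉ G H xx' yy'
         (totalMutualVisibility (combine x' y) (combine x y'))
... | inj₁ xy∉X = xy∉X xy∈X
... | inj₂ x'y'∉X = x'y'∉X x'y'∈X
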